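{- Let $(F_n)_{n\in\mathbb{Z}}$ be the Fibonacci numbers and $(G_n)_{n\in\mathbb{Z}}$ a Fibonacci-like sequence. For every positive integer $k$ and all integers $a$, $b$, $n$, $m$ the following six identities hold: \[ \sum_{j=0}^k (-1)^{(a+b+1)(k-j)}\binom kj F_{m-b}^j F_{m-a}^{k-j} G_{n-(m-b)k+(a-b)j}=F_{a-b}^k G_n, \] \[ \sum_{j=0}^k (-1)^{(a+b)j}\binom kj F_{a-b}^j F_{m-a}^{k-j} G_{n-(a-b)k+(m-b)j}=(-1)^{(a+b)k}F_{m-b}^k G_n, \] \[ \sum_{j=0}^k (-1)^{j}\binom kj F_{a-b}^j F_{m-b}^{k-j} G_{n+(a-b)k+(m-a)j}=(-1)^{(a+b)k}F_{m-a}^k G_n, \] \[ \sum_{j=0}^k (-1)^{(a+b+1)(k-j)}\binom kj F_{m+a}^j F_{m+b}^{k-j} G_{n-(m+a)k+(a-b)j}=F_{a-b}^k G_n, \] \[ \sum_{j=0}^k (-1)^{(a+b)j}\binom kj F_{a-b}^j F_{m+b}^{k-j} G_{n-(a-b)k+(m+a)j}=(-1)^{(a+b)k}F_{m+a}^k G_n, \] \[ \sum_{j=0}^k (-1)^{j}\binom kj F_{a-b}^j F_{m+a}^{k-j} G_{n+(a-b)k+(m+b)j}=(-1)^{(a+b)k}F_{m+b}^k G_n. \]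
   Context: The Fibonacci numbers are defined by $F_0=0$, $F_1=1$, $F_n=F_{n-1}+F_{n-2}$ for $n\ge 2$, and $F_{ -n}=(-1)^{n-1}F_n$. A Fibonacci-like sequence $(G_n)_{n\in\mathbb{Z}}$ is defined by arbitrary integers $G_0,G_1$, not both zero, with $G_n=G_{n-1}+G_{n-2}$ for $n\ge 2$, extended to negative indices by $G_{ -n}=G_{ -n+2}-G_{ -n+1}$. The convention $0^0=1$ is used for powers. -}

module Defs where

open import Data.Nat as ℕ using (ℕ; zero; suc)
open import Data.Integer as ℤ using (ℤ; +_; -[1+_]; _+_; _-_; _*_; -_; _^_)
open import Data.Product using (_×_; _,_; proj₁; proj₂)
open import Data.Nat.Combinatorics using (_C_)
open import Data.Bool using (if_then_else_)
open import Data.Nat using (_%_)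
open import Relation.Nullary.Decidable using (⌊_⌋)

fwdPair : ℤ → ℤ → ℕ → ℤ × ℤ
fwdPair x y zero = x , y
fwdPair x y (suc n) with fwdPair x y n
... | (p , q) = q , p + q

-- Backward pair (S_{-n}, S_{-n+1}) using S_{-n} = S_{-n+2} - S_{-n+1}.
bwdPair : ℤ → ℤ → ℕ → ℤ × ℤ
bwdPair x y zero = x , y
bwdPair x y (suc n) with bwdPair x y n
... | (p , q) = q - p , p

seqZ : ℤ → ℤ → ℤ → ℤ
seqZ x y (+ n)      = proj₁ (fwdPair x y n)
seqZ x y -[1+ n ]   = proj₁ (bwdPair x y (suc n))

F : ℤ → ℤ
F = seqZ (+ 0) (+ 1)

G : ℤ → ℤ → ℤ → ℤ
G g0 g1 = seqZ g0 g1

negOnePow : ℤ → ℤ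
negOnePow e = if ⌊ ℕ._≟_ (ℤ.∣ e ∣ % 2) 0 ⌋ then + 1 else - (+ 1)

sumTo : ℕ → (ℕ → ℤ) → ℤ
sumTo zero f = f zero
sumTo (suc k) f = sumTo k f + f (suc k)

binom : ℕ → ℕ → ℤ
binom k j = + (k C j)

-- Each identity has the shape  Σ_j C(k,j) α^j β^(k-j) G(n + S j + T (k-j)) = γ^k G(n)  and is the
-- k-fold iterate of a three-term relation  α G(n + S) + β G(n + T) = γ G(n),  expanded binomially as
-- for commuting shift operators.  The three relations needed are rearrangements of Vajda's identity
--   F(p) G(n + q) - F(q) G(n + p) = (-1)^q F(p - q) G(n),
-- which holds because both sides solve the Fibonacci recurrence in p and agree at p = q and p = q + 1,
-- the latter since F(q + 1) G(n + q) - F(q) G(n + q + 1) changes sign at every step in q.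
-- The identities only depend on x, y with x - y = a - b, so the last three are the first three at
-- (x, y) = (m + a, m + b) instead of (m - b, m - a).

module Submission where

open import Defs
open import Data.Nat as ℕ using (ℕ; zero; suc)
open import Data.Nat.Combinatorics using (_C_; nCk+nC[k+1]≡[n+1]C[k+1]; k>n⇒nCk≡0)
import Data.Nat.Properties as ℕP
open import Data.Integer using (ℤ; +_; -[1+_]; _+_; _-_; _*_; _^_; -_)
import Data.Integer.Properties as ℤP
open import Data.Integer.Tactic.RingSolver using (solve-∀)
open import Data.Product using (_×_; _,_; proj₁)
open import Relation.Binary.PropositionalEquality
  using (_≡_; refl; sym; trans; cong; cong₂; subst; module ≡-Reasoning)
open import Relation.Nullary using (¬_)

sumTo-cong : ∀ k {f g : ℕ → ℤ} → (∀ j → j ℕ.≤ k → f j ≡ g j) → sumTo k f ≡ sumTo k g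
sumTo-cong zero    f≗g = f≗g 0 ℕ.z≤n
sumTo-cong (suc k) f≗g =
  cong₂ _+_ (sumTo-cong k (λ j j≤k → f≗g j (ℕP.m≤n⇒m≤1+n j≤k))) (f≗g (suc k) ℕP.≤-refl)

sumTo-distrib-+ : ∀ k (f g : ℕ → ℤ) → sumTo k (λ j → f j + g j) ≡ sumTo k f + sumTo k g
sumTo-distrib-+ zero    f g = refl
sumTo-distrib-+ (suc k) f g =
  trans (cong (_+ (f (suc k) + g (suc k))) (sumTo-distrib-+ k f g))
        (swap (sumTo k f) (sumTo k g) (f (suc k)) (g (suc k)))
  where
  swap : ∀ (a b c d : ℤ) → a + b + (c + d) ≡ a + c + (b + d)
  swap = solve-∀

sumTo-*ˡ : ∀ k (c : ℤ) (f : ℕ → ℤ) → sumTo k (λ j → c * f j) ≡ c * sumTo k f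
sumTo-*ˡ zero    c f = refl
sumTo-*ˡ (suc k) c f =
  trans (cong (_+ c * f (suc k)) (sumTo-*ˡ k c f)) (sym (ℤP.*-distribˡ-+ c (sumTo k f) (f (suc k))))

sumTo-suc-head : ∀ k (f : ℕ → ℤ) → sumTo (suc k) f ≡ f 0 + sumTo k (λ j → f (suc j))
sumTo-suc-head zero    f = refl
sumTo-suc-head (suc k) f =
  trans (cong (_+ f (suc (suc k))) (sumTo-suc-head k f)) (ℤP.+-assoc (f 0) _ _)

binomialSum : ℕ → (ℕ → ℕ → ℤ) → ℤ
binomialSum k f = sumTo k (λ j → binom k j * f j (k ℕ.∸ j))

binomialSum-cong : ∀ k {f g : ℕ → ℕ → ℤ} → (∀ i l → f i l ≡ g i l) →
  binomialSum k f ≡ binomialSum k g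
binomialSum-cong k f≗g = sumTo-cong k (λ j _ → cong (binom k j *_) (f≗g j (k ℕ.∸ j)))

binomialSum-*ˡ : ∀ k (c : ℤ) (f : ℕ → ℕ → ℤ) →
  binomialSum k (λ i l → c * f i l) ≡ c * binomialSum k f
binomialSum-*ˡ k c f = trans (sumTo-cong k (λ j _ → swap (binom k j) c _)) (sumTo-*ˡ k c _)
  where
  swap : ∀ (b c x : ℤ) → b * (c * x) ≡ c * (b * x)
  swap = solve-∀

binomialSum-suc : ∀ k (f : ℕ → ℕ → ℤ) →
  binomialSum (suc k) f ≡ binomialSum k (λ i l → f (suc i) l) + binomialSum k (λ i l → f i (suc l))
binomialSum-suc k f = begin
    binomialSum (suc k) f
  ≡⟨ sumTo-suc-head k _ ⟩
    head + sumTo k (λ j → binom (suc k) (suc j) * f (suc j) (k ℕ.∸ j))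
  ≡⟨ cong (λ t → head + t) (trans (sumTo-cong k (λ j _ → pascal j)) (sumTo-distrib-+ k _ _)) ⟩
    head + (binomialSum k (λ i l → f (suc i) l) + R)
  ≡⟨ rotate head (binomialSum k (λ i l → f (suc i) l)) R ⟩
    binomialSum k (λ i l → f (suc i) l) + (head + R)
  ≡⟨ cong (λ t → binomialSum k (λ i l → f (suc i) l) + t) second ⟩
    binomialSum k (λ i l → f (suc i) l) + binomialSum k (λ i l → f i (suc l))
  ∎
  where
  open ≡-Reasoning
  head R : ℤ
  head = binom k 0 * f 0 (suc k)
  R = sumTo k (λ j → binom k (suc j) * f (suc j) (k ℕ.∸ j))
  pascal : ∀ j → binom (suc k) (suc j) * f (suc j) (k ℕ.∸ j)
                 ≡ binom k j * f (suc j) (k ℕ.∸ j) + binom k (suc j) * f (suc j) (k ℕ.∸ j)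
  pascal j = trans (cong (λ c → + c * f (suc j) (k ℕ.∸ j)) (sym (nCk+nC[k+1]≡[n+1]C[k+1] k j)))
                   (ℤP.*-distribʳ-+ _ (binom k j) (binom k (suc j)))
  rotate : ∀ (x a b : ℤ) → x + (a + b) ≡ a + (x + b)
  rotate = solve-∀
  -- the extra top term carries the coefficient C(k, k+1) = 0
  second : head + R ≡ binomialSum k (λ i l → f i (suc l))
  second = begin
      head + R
    ≡⟨ sym (sumTo-suc-head k _) ⟩
      sumTo k (λ j → binom k j * f j (suc k ℕ.∸ j)) + binom k (suc k) * f (suc k) (k ℕ.∸ k)
    ≡⟨ cong₂ _+_ (sumTo-cong k (λ j j≤k → cong (λ l → binom k j * f j l) (ℕP.+-∸-assoc 1 j≤k)))
                 (cong (λ c → + c * f (suc k) (k ℕ.∸ k)) (k>n⇒nCk≡0 (ℕP.n<1+n k))) ⟩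
      binomialSum k (λ i l → f i (suc l)) + + 0 * f (suc k) (k ℕ.∸ k)
    ≡⟨ ℤP.+-identityʳ _ ⟩
      binomialSum k (λ i l → f i (suc l))
    ∎

binomial-iteration : (u : ℤ → ℤ) (α β γ S T : ℤ) →
  (∀ n → α * u (n + S) + β * u (n + T) ≡ γ * u n) →
  ∀ k n → binomialSum k (λ i l → α ^ i * β ^ l * u (n + S * + i + T * + l)) ≡ γ ^ k * u n
binomial-iteration u α β γ S T relation = iterate
  where
  shiftS : ∀ (n S T I L : ℤ) → n + S * (+ 1 + I) + T * L ≡ (n + S) + S * I + T * L
  shiftS = solve-∀
  shiftT : ∀ (n S T I L : ℤ) → n + S * I + T * (+ 1 + L) ≡ (n + T) + S * I + T * L
  shiftT = solve-∀
  noShift : ∀ (n S T : ℤ) → n + S * + 0 + T * + 0 ≡ n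
  noShift = solve-∀
  iterate : ∀ k n → binomialSum k (λ i l → α ^ i * β ^ l * u (n + S * + i + T * + l)) ≡ γ ^ k * u n
  iterate zero    n = trans (cong (λ m → + 1 * (+ 1 * + 1 * u m)) (noShift n S T)) (unit (u n))
    where
    unit : ∀ (x : ℤ) → + 1 * (+ 1 * + 1 * x) ≡ + 1 * x
    unit = solve-∀
  iterate (suc k) n = begin
      binomialSum (suc k) (term n)
    ≡⟨ binomialSum-suc k (term n) ⟩
      binomialSum k (λ i l → term n (suc i) l) + binomialSum k (λ i l → term n i (suc l))
    ≡⟨ cong₂ _+_ (binomialSum-cong k α-step) (binomialSum-cong k β-step) ⟩
      binomialSum k (λ i l → α * term (n + S) i l) + binomialSum k (λ i l → β * term (n + T) i l)
    ≡⟨ cong₂ _+_ (binomialSum-*ˡ k α (term (n + S))) (binomialSum-*ˡ k β (term (n + T))) ⟩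
      α * binomialSum k (term (n + S)) + β * binomialSum k (term (n + T))
    ≡⟨ cong₂ (λ x y → α * x + β * y) (iterate k (n + S)) (iterate k (n + T)) ⟩
      α * (γ ^ k * u (n + S)) + β * (γ ^ k * u (n + T))
    ≡⟨ factor α β (γ ^ k) (u (n + S)) (u (n + T)) ⟩
      γ ^ k * (α * u (n + S) + β * u (n + T))
    ≡⟨ cong (γ ^ k *_) (relation n) ⟩
      γ ^ k * (γ * u n)
    ≡⟨ regroup (γ ^ k) γ (u n) ⟩
      γ ^ suc k * u n
    ∎
    where
    open ≡-Reasoning
    term : ℤ → ℕ → ℕ → ℤ
    term m i l = α ^ i * β ^ l * u (m + S * + i + T * + l)
    α-step : ∀ i l → term n (suc i) l ≡ α * term (n + S) i l
    α-step i l = trans (cong (λ m → α ^ suc i * β ^ l * u m) (shiftS n S T (+ i) (+ l)))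
                       (pull α (α ^ i) (β ^ l) _)
      where
      pull : ∀ (a x y g : ℤ) → a * x * y * g ≡ a * (x * y * g)
      pull = solve-∀
    β-step : ∀ i l → term n i (suc l) ≡ β * term (n + T) i l
    β-step i l = trans (cong (λ m → α ^ i * β ^ suc l * u m) (shiftT n S T (+ i) (+ l)))
                       (pull β (α ^ i) (β ^ l) _)
      where
      pull : ∀ (b x y g : ℤ) → x * (b * y) * g ≡ b * (x * y * g)
      pull = solve-∀
    factor : ∀ (a b c x y : ℤ) → a * (c * x) + b * (c * y) ≡ c * (a * x + b * y)
    factor = solve-∀
    regroup : ∀ (c g x : ℤ) → c * (g * x) ≡ g * c * x
    regroup = solve-∀

ℤ-induction : (P : ℤ → Set) → P (+ 0) →
  (∀ y → P y → P (y + + 1)) → (∀ y → P y → P (y - + 1)) → ∀ y → P y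
ℤ-induction P base up down (+ zero)     = base
ℤ-induction P base up down (+ suc i)    =
  subst (λ t → P (+ t)) (ℕP.+-comm i 1) (up (+ i) (ℤ-induction P base up down (+ i)))
ℤ-induction P base up down -[1+ zero ]  = down (+ 0) base
ℤ-induction P base up down -[1+ suc i ] =
  subst (λ t → P -[1+ suc t ]) (ℕP.+-identityʳ i) (down -[1+ i ] (ℤ-induction P base up down -[1+ i ]))

pred-suc : ∀ (y : ℤ) → y - + 1 + + 1 ≡ y
pred-suc = solve-∀

antiperiodic-pred : (w : ℤ → ℤ) → (∀ q → w (q + + 1) ≡ - w q) → ∀ q → w (q - + 1) ≡ - w q
antiperiodic-pred w step q = begin
    w (q - + 1)            ≡⟨ sym (ℤP.neg-involutive _) ⟩
    - - w (q - + 1)        ≡⟨ cong -_ (sym (step (q - + 1))) ⟩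
    - w (q - + 1 + + 1)    ≡⟨ cong (λ t → - w t) (pred-suc q) ⟩
    - w q                  ∎
  where open ≡-Reasoning

negOnePow-suc : ∀ n → negOnePow (+ suc n) ≡ - negOnePow (+ n)
negOnePow-suc zero    = refl
negOnePow-suc (suc n) = sym (trans (cong -_ (negOnePow-suc n)) (ℤP.neg-involutive _))

negOnePow-+1 : ∀ q → negOnePow (q + + 1) ≡ - negOnePow q
negOnePow-+1 (+ i)         = trans (cong (λ t → negOnePow (+ t)) (ℕP.+-comm i 1)) (negOnePow-suc i)
negOnePow-+1 -[1+ zero ]   = refl
negOnePow-+1 -[1+ suc i ]  = trans (sym (ℤP.neg-involutive _)) (cong -_ (sym (negOnePow-suc (suc i))))

antiperiodic : (w : ℤ → ℤ) → (∀ q → w (q + + 1) ≡ - w q) → ∀ q → w q ≡ negOnePow q * w (+ 0)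
antiperiodic w step = ℤ-induction (λ q → w q ≡ negOnePow q * w (+ 0)) (sym (ℤP.*-identityˡ _))
  (λ q → flip (step q) (negOnePow-+1 q))
  (λ q → flip (antiperiodic-pred w step q) (antiperiodic-pred negOnePow negOnePow-+1 q))
  where
  flip : ∀ {q r} → w r ≡ - w q → negOnePow r ≡ - negOnePow q →
         w q ≡ negOnePow q * w (+ 0) → w r ≡ negOnePow r * w (+ 0)
  flip {q} {r} w-flip σ-flip hyp = begin
      w r                            ≡⟨ w-flip ⟩
      - w q                          ≡⟨ cong -_ hyp ⟩
      - (negOnePow q * w (+ 0))      ≡⟨ ℤP.neg-distribˡ-* (negOnePow q) (w (+ 0)) ⟩
      - negOnePow q * w (+ 0)        ≡⟨ cong (_* w (+ 0)) (sym σ-flip) ⟩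
      negOnePow r * w (+ 0)          ∎
    where open ≡-Reasoning

negOnePow-+ : ∀ x y → negOnePow (x + y) ≡ negOnePow x * negOnePow y
negOnePow-+ x y = begin
    negOnePow (x + y)                      ≡⟨ antiperiodic (λ t → negOnePow (x + t)) step y ⟩
    negOnePow y * negOnePow (x + + 0)      ≡⟨ cong (λ t → negOnePow y * negOnePow t) (ℤP.+-identityʳ x) ⟩
    negOnePow y * negOnePow x              ≡⟨ ℤP.*-comm (negOnePow y) _ ⟩
    negOnePow x * negOnePow y              ∎
  where
  open ≡-Reasoning
  step : ∀ t → negOnePow (x + (t + + 1)) ≡ - negOnePow (x + t)
  step t = trans (cong negOnePow (sym (ℤP.+-assoc x t (+ 1)))) (negOnePow-+1 (x + t))

negOnePow-square : ∀ x → negOnePow x * negOnePow x ≡ + 1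
negOnePow-square = ℤ-induction (λ x → negOnePow x * negOnePow x ≡ + 1) refl
  (λ q hyp → trans (cong₂ _*_ (negOnePow-+1 q) (negOnePow-+1 q)) (trans (neg*neg (negOnePow q)) hyp))
  (λ q hyp → trans (cong₂ _*_ (antiperiodic-pred negOnePow negOnePow-+1 q)
                              (antiperiodic-pred negOnePow negOnePow-+1 q)) (trans (neg*neg (negOnePow q)) hyp))
  where
  neg*neg : ∀ (a : ℤ) → - a * - a ≡ a * a
  neg*neg = solve-∀

negOnePow-*-ℕ : ∀ c j → negOnePow (c * + j) ≡ negOnePow c ^ j
negOnePow-*-ℕ c zero    = cong negOnePow (ℤP.*-zeroʳ c)
negOnePow-*-ℕ c (suc j) = begin
    negOnePow (c * (+ 1 + + j))            ≡⟨ cong negOnePow (unfold c (+ j)) ⟩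
    negOnePow (c + c * + j)                ≡⟨ negOnePow-+ c (c * + j) ⟩
    negOnePow c * negOnePow (c * + j)      ≡⟨ cong (negOnePow c *_) (negOnePow-*-ℕ c j) ⟩
    negOnePow c ^ suc j                    ∎
  where
  open ≡-Reasoning
  unfold : ∀ (c J : ℤ) → c * (+ 1 + J) ≡ c + c * J
  unfold = solve-∀

negOnePow-+≡negOnePow-- : ∀ a b → negOnePow (a + b) ≡ negOnePow (a - b)
negOnePow-+≡negOnePow-- a b = begin
    negOnePow (a + b)                              ≡⟨ cong negOnePow (regroup a b) ⟩
    negOnePow (a - b + (b + b))                    ≡⟨ negOnePow-+ (a - b) (b + b) ⟩
    negOnePow (a - b) * negOnePow (b + b)          ≡⟨ cong (negOnePow (a - b) *_) (negOnePow-+ b b) ⟩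
    negOnePow (a - b) * (negOnePow b * negOnePow b) ≡⟨ cong (negOnePow (a - b) *_) (negOnePow-square b) ⟩
    negOnePow (a - b) * + 1                        ≡⟨ ℤP.*-identityʳ _ ⟩
    negOnePow (a - b)                              ∎
  where
  open ≡-Reasoning
  regroup : ∀ (a b : ℤ) → a + b ≡ a - b + (b + b)
  regroup = solve-∀

record IsFibonacciLike (u : ℤ → ℤ) : Set where
  constructor fibonacciLike
  field
    recurrence : ∀ n → u (n + + 2) ≡ u (n + + 1) + u n

open IsFibonacciLike

fwdPair-suc-suc : ∀ x y n →
  proj₁ (fwdPair x y (suc (suc n))) ≡ proj₁ (fwdPair x y (suc n)) + proj₁ (fwdPair x y n)
fwdPair-suc-suc x y n with fwdPair x y n
... | (p , q) = ℤP.+-comm p q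

bwdPair-suc-suc : ∀ x y n →
  proj₁ (bwdPair x y (suc (suc n))) ≡ proj₁ (bwdPair x y n) - proj₁ (bwdPair x y (suc n))
bwdPair-suc-suc x y n with bwdPair x y n
... | (p , q) = refl

seqZ-recurrence : ∀ x y n → seqZ x y (n + + 2) ≡ seqZ x y (n + + 1) + seqZ x y n
seqZ-recurrence x y (+ i) rewrite ℕP.+-comm i 2 | ℕP.+-comm i 1 = fwdPair-suc-suc x y i
seqZ-recurrence x y -[1+ zero ]        = step-at-minus-one x y
  where
  step-at-minus-one : ∀ (x y : ℤ) → y ≡ x + (y - x)
  step-at-minus-one = solve-∀
seqZ-recurrence x y -[1+ suc zero ]    = step-at-minus-two x y
  where
  step-at-minus-two : ∀ (x y : ℤ) → x ≡ y - x + (x - (y - x))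
  step-at-minus-two = solve-∀
seqZ-recurrence x y -[1+ suc (suc i) ] =
  trans (rearrange (proj₁ (bwdPair x y (suc i))) (proj₁ (bwdPair x y (suc (suc i)))))
        (cong (λ t → proj₁ (bwdPair x y (suc (suc i))) + t) (sym (bwdPair-suc-suc x y (suc i))))
  where
  rearrange : ∀ (a b : ℤ) → a ≡ b + (a - b)
  rearrange = solve-∀

seqZ-isFibonacciLike : ∀ x y → IsFibonacciLike (seqZ x y)
seqZ-isFibonacciLike x y = fibonacciLike (seqZ-recurrence x y)

fibonacciLike-suc-suc : ∀ {u} → IsFibonacciLike u → ∀ n → u (n + + 1 + + 1) ≡ u (n + + 1) + u n
fibonacciLike-suc-suc {u} u-fib n = trans (cong u (ℤP.+-assoc n (+ 1) (+ 1))) (recurrence u-fib n)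

fibonacciLike-pred : ∀ {u} → IsFibonacciLike u → ∀ n → u (n - + 1) ≡ u (n + + 1) - u n
fibonacciLike-pred {u} u-fib n = begin
    u (n - + 1)                                  ≡⟨ solve-for (u (n - + 1)) (u n) ⟩
    u n + u (n - + 1) - u n                      ≡⟨ cong (λ t → u t + u (n - + 1) - u n) (sym (pred-suc n)) ⟩
    u (n - + 1 + + 1) + u (n - + 1) - u n        ≡⟨ cong (_- u n) (sym (recurrence u-fib (n - + 1))) ⟩
    u (n - + 1 + + 2) - u n                      ≡⟨ cong (λ t → u t - u n) (two-back n) ⟩
    u (n + + 1) - u n                            ∎
  where
  open ≡-Reasoning
  solve-for : ∀ (a b : ℤ) → a ≡ b + a - b
  solve-for = solve-∀
  two-back : ∀ (n : ℤ) → n - + 1 + + 2 ≡ n + + 1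
  two-back = solve-∀

fibonacciLike-unique₀ : ∀ {u v} → IsFibonacciLike u → IsFibonacciLike v →
  u (+ 0) ≡ v (+ 0) → u (+ 1) ≡ v (+ 1) → ∀ n → u n ≡ v n
fibonacciLike-unique₀ {u} {v} u-fib v-fib eq₀ eq₁ n =
  proj₁ (ℤ-induction (λ y → u y ≡ v y × u (y + + 1) ≡ v (y + + 1)) (eq₀ , eq₁) up down n)
  where
  up : ∀ y → u y ≡ v y × u (y + + 1) ≡ v (y + + 1) →
       u (y + + 1) ≡ v (y + + 1) × u (y + + 1 + + 1) ≡ v (y + + 1 + + 1)
  up y (eq , eq′) = eq′ , trans (fibonacciLike-suc-suc u-fib y)
                         (trans (cong₂ _+_ eq′ eq) (sym (fibonacciLike-suc-suc v-fib y)))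
  down : ∀ y → u y ≡ v y × u (y + + 1) ≡ v (y + + 1) →
         u (y - + 1) ≡ v (y - + 1) × u (y - + 1 + + 1) ≡ v (y - + 1 + + 1)
  down y (eq , eq′) =
    trans (fibonacciLike-pred u-fib y) (trans (cong₂ _-_ eq′ eq) (sym (fibonacciLike-pred v-fib y))) ,
    trans (cong u (pred-suc y)) (trans eq (cong v (sym (pred-suc y))))

isFibonacciLike-shiftˡ : ∀ {u} → IsFibonacciLike u → ∀ c → IsFibonacciLike (λ p → u (c + p))
isFibonacciLike-shiftˡ {u} u-fib c = fibonacciLike λ n →
  trans (cong u (sym (ℤP.+-assoc c n (+ 2))))
        (trans (recurrence u-fib (c + n)) (cong (λ t → u t + u (c + n)) (ℤP.+-assoc c n (+ 1))))

isFibonacciLike-shiftʳ : ∀ {u} → IsFibonacciLike u → ∀ c → IsFibonacciLike (λ p → u (p + c))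
isFibonacciLike-shiftʳ {u} u-fib c = fibonacciLike λ n →
  trans (cong u (swap n (+ 2) c))
        (trans (recurrence u-fib (n + c)) (cong (λ t → u t + u (n + c)) (sym (swap n (+ 1) c))))
  where
  swap : ∀ (n d c : ℤ) → n + d + c ≡ n + c + d
  swap = solve-∀

isFibonacciLike-*ˡ : ∀ {u} → IsFibonacciLike u → ∀ x → IsFibonacciLike (λ p → x * u p)
isFibonacciLike-*ˡ {u} u-fib x = fibonacciLike λ n →
  trans (cong (x *_) (recurrence u-fib n)) (ℤP.*-distribˡ-+ x (u (n + + 1)) (u n))

isFibonacciLike-*ʳ : ∀ {u} → IsFibonacciLike u → ∀ x → IsFibonacciLike (λ p → u p * x)
isFibonacciLike-*ʳ {u} u-fib x = fibonacciLike λ n →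
  trans (cong (_* x) (recurrence u-fib n)) (ℤP.*-distribʳ-+ x (u (n + + 1)) (u n))

isFibonacciLike-- : ∀ {u w} → IsFibonacciLike u → IsFibonacciLike w → IsFibonacciLike (λ p → u p - w p)
isFibonacciLike-- {u} {w} u-fib w-fib = fibonacciLike λ n →
  trans (cong₂ _-_ (recurrence u-fib n) (recurrence w-fib n)) (interchange (u (n + + 1)) (u n) (w (n + + 1)) (w n))
  where
  interchange : ∀ (a b c d : ℤ) → a + b - (c + d) ≡ (a - c) + (b - d)
  interchange = solve-∀

fibonacciLike-unique : ∀ {u v} → IsFibonacciLike u → IsFibonacciLike v → ∀ c →
  u c ≡ v c → u (c + + 1) ≡ v (c + + 1) → ∀ n → u n ≡ v n
fibonacciLike-unique {u} {v} u-fib v-fib c eq₀ eq₁ n = begin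
    u n                 ≡⟨ cong u (sym (return c n)) ⟩
    u (c + (n - c))     ≡⟨ shifted (n - c) ⟩
    v (c + (n - c))     ≡⟨ cong v (return c n) ⟩
    v n                 ∎
  where
  open ≡-Reasoning
  return : ∀ (c n : ℤ) → c + (n - c) ≡ n
  return = solve-∀
  shifted : ∀ p → u (c + p) ≡ v (c + p)
  shifted = fibonacciLike-unique₀ (isFibonacciLike-shiftˡ u-fib c) (isFibonacciLike-shiftˡ v-fib c)
              (trans (cong u (ℤP.+-identityʳ c)) (trans eq₀ (cong v (sym (ℤP.+-identityʳ c))))) eq₁

F-isFibonacciLike : IsFibonacciLike F
F-isFibonacciLike = seqZ-isFibonacciLike (+ 0) (+ 1)

vajda-succ : ∀ {u} → IsFibonacciLike u → ∀ q →
  F (q + + 1) * u q - F q * u (q + + 1) ≡ negOnePow q * u (+ 0)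
vajda-succ {u} u-fib q = trans (antiperiodic w flip q) (cong (negOnePow q *_) (initial (u (+ 0)) (u (+ 1))))
  where
  w : ℤ → ℤ
  w q = F (q + + 1) * u q - F q * u (q + + 1)
  initial : ∀ (a b : ℤ) → + 1 * a - + 0 * b ≡ a
  initial = solve-∀
  cross : ∀ (f₁ f₀ u₁ u₀ : ℤ) → (f₁ + f₀) * u₁ - f₁ * (u₁ + u₀) ≡ - (f₁ * u₀ - f₀ * u₁)
  cross = solve-∀
  flip : ∀ q → w (q + + 1) ≡ - w q
  flip q = trans (cong₂ (λ f v → f * u (q + + 1) - F (q + + 1) * v)
                        (fibonacciLike-suc-suc F-isFibonacciLike q) (fibonacciLike-suc-suc u-fib q))
                 (cross (F (q + + 1)) (F q) (u (q + + 1)) (u q))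

vajda : ∀ {u} → IsFibonacciLike u → ∀ n p q →
  F p * u (n + q) - F q * u (n + p) ≡ negOnePow q * F (p - q) * u n
vajda {u} u-fib n p q = fibonacciLike-unique lhs-fib rhs-fib q at-q at-suc-q p
  where
  lhs-fib : IsFibonacciLike (λ p → F p * u (n + q) - F q * u (n + p))
  lhs-fib = isFibonacciLike-- (isFibonacciLike-*ʳ F-isFibonacciLike (u (n + q)))
                              (isFibonacciLike-*ˡ (isFibonacciLike-shiftˡ u-fib n) (F q))
  rhs-fib : IsFibonacciLike (λ p → negOnePow q * F (p - q) * u n)
  rhs-fib = isFibonacciLike-*ʳ
              (isFibonacciLike-*ˡ (isFibonacciLike-shiftʳ F-isFibonacciLike (- q)) (negOnePow q)) (u n)
  vanish : ∀ (a b : ℤ) → a * + 0 * b ≡ + 0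
  vanish = solve-∀
  at-q : F q * u (n + q) - F q * u (n + q) ≡ negOnePow q * F (q - q) * u n
  at-q = trans (ℤP.+-inverseʳ (F q * u (n + q)))
               (sym (trans (cong (λ t → negOnePow q * F t * u n) (ℤP.+-inverseʳ q))
                           (vanish (negOnePow q) (u n))))
  one-step : ∀ (q : ℤ) → q + + 1 - q ≡ + 1
  one-step = solve-∀
  unit : ∀ (a b : ℤ) → a * + 1 * b ≡ a * b
  unit = solve-∀
  at-suc-q : F (q + + 1) * u (n + q) - F q * u (n + (q + + 1)) ≡ negOnePow q * F (q + + 1 - q) * u n
  at-suc-q = begin
      F (q + + 1) * u (n + q) - F q * u (n + (q + + 1))  ≡⟨ vajda-succ (isFibonacciLike-shiftˡ u-fib n) q ⟩
      negOnePow q * u (n + + 0)                          ≡⟨ cong (λ t → negOnePow q * u t) (ℤP.+-identityʳ n) ⟩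
      negOnePow q * u n                                  ≡⟨ sym (unit (negOnePow q) (u n)) ⟩
      negOnePow q * F (+ 1) * u n                        ≡⟨ cong (λ t → negOnePow q * F t * u n) (sym (one-step q)) ⟩
      negOnePow q * F (q + + 1 - q) * u n                ∎
    where open ≡-Reasoning

vajda-backward : ∀ {u} → IsFibonacciLike u → ∀ x y n →
  F x * u (n - y) - negOnePow (x - y) * F y * u (n - x) ≡ F (x - y) * u n
vajda-backward {u} u-fib x y n = begin
    F x * u (n - y) - negOnePow (x - y) * F y * u (n - x)
  ≡⟨ cong₂ (λ i f → F x * u i - negOnePow (x - y) * F f * u (n - x))
           (sym (shift₁ n x y)) (sym (shift₂ x y)) ⟩
    A - negOnePow (x - y) * F (x - (x - y)) * u (n - x)
  ≡⟨ cong (λ t → A - t) (sym (vajda u-fib (n - x) x (x - y))) ⟩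
    A - (A - F (x - y) * u (n - x + x))
  ≡⟨ cancel A _ ⟩
    F (x - y) * u (n - x + x)
  ≡⟨ cong (λ i → F (x - y) * u i) (shift₃ n x) ⟩
    F (x - y) * u n
  ∎
  where
  open ≡-Reasoning
  A : ℤ
  A = F x * u (n - x + (x - y))
  shift₁ : ∀ (n x y : ℤ) → n - x + (x - y) ≡ n - y
  shift₁ = solve-∀
  shift₂ : ∀ (x y : ℤ) → x - (x - y) ≡ y
  shift₂ = solve-∀
  shift₃ : ∀ (n x : ℤ) → n - x + x ≡ n
  shift₃ = solve-∀
  cancel : ∀ (a b : ℤ) → a - (a - b) ≡ b
  cancel = solve-∀

vajda-forward : ∀ {u} → IsFibonacciLike u → ∀ y z n →
  negOnePow z * F z * u (n + y) + F y * u (n - z) ≡ negOnePow z * F (y + z) * u n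
vajda-forward {u} u-fib y z n = begin
    σ * F z * u (n + y) + R
  ≡⟨ expand σ (F z) (u (n + y)) R ⟩
    σ * (F z * u (n + y) + σ * R) + (+ 1 - σ * σ) * R
  ≡⟨ cong₂ (λ t e → σ * (F z * u (n + y) + t) + (+ 1 - e) * R) shifted (negOnePow-square z) ⟩
    σ * (F z * u (n + y) + (F (y + z) * u n - F z * u (n + y))) + (+ 1 - + 1) * R
  ≡⟨ collapse σ (F z * u (n + y)) (F (y + z)) (u n) R ⟩
    σ * F (y + z) * u n
  ∎
  where
  open ≡-Reasoning
  σ R : ℤ
  σ = negOnePow z
  R = F y * u (n - z)
  expand : ∀ (s f g r : ℤ) → s * f * g + r ≡ s * (f * g + s * r) + (+ 1 - s * s) * r
  expand = solve-∀
  collapse : ∀ (s q f g r : ℤ) → s * (q + (f * g - q)) + (+ 1 - + 1) * r ≡ s * f * g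
  collapse = solve-∀
  shift₁ : ∀ (n z : ℤ) → n - z + z ≡ n
  shift₁ = solve-∀
  shift₂ : ∀ (n y z : ℤ) → n - z + (y + z) ≡ n + y
  shift₂ = solve-∀
  shift₃ : ∀ (y z : ℤ) → y + z - z ≡ y
  shift₃ = solve-∀
  shifted : σ * R ≡ F (y + z) * u n - F z * u (n + y)
  shifted = begin
      σ * (F y * u (n - z))                            ≡⟨ sym (ℤP.*-assoc σ (F y) (u (n - z))) ⟩
      σ * F y * u (n - z)                              ≡⟨ cong (λ t → σ * F t * u (n - z)) (sym (shift₃ y z)) ⟩
      σ * F (y + z - z) * u (n - z)                    ≡⟨ sym (vajda u-fib (n - z) (y + z) z) ⟩
      F (y + z) * u (n - z + z) - F z * u (n - z + (y + z))
        ≡⟨ cong₂ (λ i j → F (y + z) * u i - F z * u j) (shift₁ n z) (shift₂ n y z) ⟩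
      F (y + z) * u n - F z * u (n + y)                ∎

^-distrib-* : ∀ x y n → (x * y) ^ n ≡ x ^ n * y ^ n
^-distrib-* x y zero    = refl
^-distrib-* x y (suc n) = trans (cong (x * y *_) (^-distrib-* x y n)) (interchange x y (x ^ n) (y ^ n))
  where
  interchange : ∀ (x y a b : ℤ) → x * y * (a * b) ≡ x * a * (y * b)
  interchange = solve-∀

absorbˡ : ∀ (σ c X Y g : ℤ) i l → σ ^ i * c * X ^ i * Y ^ l * g ≡ c * ((σ * X) ^ i * Y ^ l * g)
absorbˡ σ c X Y g i l =
  trans (regroup (σ ^ i) c (X ^ i) (Y ^ l) g) (cong (λ t → c * (t * Y ^ l * g)) (sym (^-distrib-* σ X i)))
  where
  regroup : ∀ (s c x y g : ℤ) → s * c * x * y * g ≡ c * (s * x * y * g)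
  regroup = solve-∀

absorbʳ : ∀ (σ c X Y g : ℤ) i l → σ ^ l * c * X ^ i * Y ^ l * g ≡ c * (X ^ i * (σ * Y) ^ l * g)
absorbʳ σ c X Y g i l =
  trans (regroup (σ ^ l) c (X ^ i) (Y ^ l) g) (cong (λ t → c * (X ^ i * t * g)) (sym (^-distrib-* σ Y l)))
  where
  regroup : ∀ (s c x y g : ℤ) → s * c * x * y * g ≡ c * (x * (s * y) * g)
  regroup = solve-∀

negOnePow-*-power : ∀ c X g k → negOnePow (c * + k) * X ^ k * g ≡ (negOnePow c * X) ^ k * g
negOnePow-*-power c X g k =
  cong (_* g) (trans (cong (_* X ^ k) (negOnePow-*-ℕ c k)) (sym (^-distrib-* (negOnePow c) X k)))

+k≡+j++[k∸j] : ∀ {j k} → j ℕ.≤ k → + k ≡ + j + + (k ℕ.∸ j)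
+k≡+j++[k∸j] j≤k = cong +_ (sym (ℕP.m+[n∸m]≡n j≤k))

+k-+j≡+[k∸j] : ∀ {j k} → j ℕ.≤ k → + k - + j ≡ + (k ℕ.∸ j)
+k-+j≡+[k∸j] {j} {k} j≤k = trans (ℤP.m-n≡m⊖n k j) (ℤP.⊖-≥ j≤k)

x-y≡z⇒x≡y+z : ∀ x y {z} → x - y ≡ z → x ≡ y + z
x-y≡z⇒x≡y+z x y d = trans (rearrange x y) (cong (λ t → y + t) d)
  where
  rearrange : ∀ (x y : ℤ) → x ≡ y + (x - y)
  rearrange = solve-∀

binomial-identity₁ : ∀ {u} → IsFibonacciLike u → ∀ k a b n x y → x - y ≡ a - b →
  sumTo k (λ j → negOnePow ((a + b + + 1) * (+ k - + j)) * binom k j * (F x ^ j) * (F y ^ (k ℕ.∸ j))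
                 * u (n - x * + k + (a - b) * + j))
    ≡ (F (a - b) ^ k) * u n
binomial-identity₁ {u} u-fib k a b n x y d =
  trans (sumTo-cong k term) (binomial-iteration u (F x) (σ * F y) (F (a - b)) (- y) (- x) relation k n)
  where
  σ : ℤ
  σ = negOnePow (a + b + + 1)
  sign : σ ≡ - negOnePow (x - y)
  sign = trans (negOnePow-+1 (a + b)) (cong -_ (trans (negOnePow-+≡negOnePow-- a b) (cong negOnePow (sym d))))
  plus-neg : ∀ (a s f g : ℤ) → a + - s * f * g ≡ a - s * f * g
  plus-neg = solve-∀
  relation : ∀ m → F x * u (m + - y) + σ * F y * u (m + - x) ≡ F (a - b) * u m
  relation m = begin
      F x * u (m - y) + σ * F y * u (m - x)
    ≡⟨ cong (λ s → F x * u (m - y) + s * F y * u (m - x)) sign ⟩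
      F x * u (m - y) + - negOnePow (x - y) * F y * u (m - x)
    ≡⟨ plus-neg (F x * u (m - y)) (negOnePow (x - y)) (F y) (u (m - x)) ⟩
      F x * u (m - y) - negOnePow (x - y) * F y * u (m - x)
    ≡⟨ vajda-backward u-fib x y m ⟩
      F (x - y) * u m
    ≡⟨ cong (λ t → F t * u m) d ⟩
      F (a - b) * u m
    ∎
    where open ≡-Reasoning
  regroup : ∀ (n x y J L : ℤ) → n - x * (J + L) + (x - y) * J ≡ n + - y * J + - x * L
  regroup = solve-∀
  term : ∀ j → j ℕ.≤ k →
    negOnePow ((a + b + + 1) * (+ k - + j)) * binom k j * F x ^ j * F y ^ (k ℕ.∸ j) * u (n - x * + k + (a - b) * + j)
      ≡ binom k j * (F x ^ j * (σ * F y) ^ (k ℕ.∸ j) * u (n + - y * + j + - x * + (k ℕ.∸ j)))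
  term j j≤k =
    trans (cong₂ (λ s i → s * binom k j * F x ^ j * F y ^ (k ℕ.∸ j) * u i) sign-power index)
          (absorbʳ σ (binom k j) (F x) (F y) _ j (k ℕ.∸ j))
    where
    sign-power : negOnePow ((a + b + + 1) * (+ k - + j)) ≡ σ ^ (k ℕ.∸ j)
    sign-power = trans (cong (λ t → negOnePow ((a + b + + 1) * t)) (+k-+j≡+[k∸j] j≤k))
                       (negOnePow-*-ℕ (a + b + + 1) (k ℕ.∸ j))
    index : n - x * + k + (a - b) * + j ≡ n + - y * + j + - x * + (k ℕ.∸ j)
    index = trans (cong₂ (λ K z → n - x * K + z * + j) (+k≡+j++[k∸j] j≤k) (sym d))
                  (regroup n x y (+ j) (+ (k ℕ.∸ j)))

binomial-identity₂ : ∀ {u} → IsFibonacciLike u → ∀ k a b n x y → x - y ≡ a - b →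
  sumTo k (λ j → negOnePow ((a + b) * + j) * binom k j * (F (a - b) ^ j) * (F y ^ (k ℕ.∸ j))
                 * u (n - (a - b) * + k + x * + j))
    ≡ negOnePow ((a + b) * + k) * (F x ^ k) * u n
binomial-identity₂ {u} u-fib k a b n x y d =
  trans (sumTo-cong k term)
        (trans (binomial-iteration u (σ * F (a - b)) (F y) (σ * F x) y (- (a - b)) relation k n)
               (sym (negOnePow-*-power (a + b) (F x) (u n) k)))
  where
  σ : ℤ
  σ = negOnePow (a + b)
  relation : ∀ m → σ * F (a - b) * u (m + y) + F y * u (m + - (a - b)) ≡ σ * F x * u m
  relation m = subst (λ s → s * F (a - b) * u (m + y) + F y * u (m - (a - b)) ≡ s * F x * u m)
                     (sym (negOnePow-+≡negOnePow-- a b))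
                     (trans (vajda-forward u-fib y (a - b) m)
                            (cong (λ t → negOnePow (a - b) * F t * u m) (sym (x-y≡z⇒x≡y+z x y d))))
  regroup : ∀ (n y z J L : ℤ) → n - z * (J + L) + (y + z) * J ≡ n + y * J + - z * L
  regroup = solve-∀
  term : ∀ j → j ℕ.≤ k →
    negOnePow ((a + b) * + j) * binom k j * F (a - b) ^ j * F y ^ (k ℕ.∸ j) * u (n - (a - b) * + k + x * + j)
      ≡ binom k j * ((σ * F (a - b)) ^ j * F y ^ (k ℕ.∸ j) * u (n + y * + j + - (a - b) * + (k ℕ.∸ j)))
  term j j≤k =
    trans (cong₂ (λ s i → s * binom k j * F (a - b) ^ j * F y ^ (k ℕ.∸ j) * u i)
                 (negOnePow-*-ℕ (a + b) j) index)
          (absorbˡ σ (binom k j) (F (a - b)) (F y) _ j (k ℕ.∸ j))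
    where
    index : n - (a - b) * + k + x * + j ≡ n + y * + j + - (a - b) * + (k ℕ.∸ j)
    index = trans (cong₂ (λ K t → n - (a - b) * K + t * + j) (+k≡+j++[k∸j] j≤k) (x-y≡z⇒x≡y+z x y d))
                  (regroup n y (a - b) (+ j) (+ (k ℕ.∸ j)))

binomial-identity₃ : ∀ {u} → IsFibonacciLike u → ∀ k a b n x y → x - y ≡ a - b →
  sumTo k (λ j → negOnePow (+ j) * binom k j * (F (a - b) ^ j) * (F x ^ (k ℕ.∸ j))
                 * u (n + (a - b) * + k + y * + j))
    ≡ negOnePow ((a + b) * + k) * (F y ^ k) * u n
binomial-identity₃ {u} u-fib k a b n x y d =
  trans (sumTo-cong k term)
        (trans (binomial-iteration u (- + 1 * F (a - b)) (F x) (negOnePow (a + b) * F y) x (a - b) relation k n)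
               (sym (negOnePow-*-power (a + b) (F y) (u n) k)))
  where
  reorder : ∀ (f g h : ℤ) → - + 1 * f * g + h ≡ h - f * g
  reorder = solve-∀
  back : ∀ (x y : ℤ) → x - (x - y) ≡ y
  back = solve-∀
  relation : ∀ m → - + 1 * F (a - b) * u (m + x) + F x * u (m + (a - b)) ≡ negOnePow (a + b) * F y * u m
  relation m = begin
      - + 1 * F (a - b) * u (m + x) + F x * u (m + (a - b))
    ≡⟨ reorder (F (a - b)) (u (m + x)) (F x * u (m + (a - b))) ⟩
      F x * u (m + (a - b)) - F (a - b) * u (m + x)
    ≡⟨ vajda u-fib m x (a - b) ⟩
      negOnePow (a - b) * F (x - (a - b)) * u m
    ≡⟨ cong₂ (λ s t → s * F t * u m) (sym (negOnePow-+≡negOnePow-- a b))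
                                     (trans (cong (λ t → x - t) (sym d)) (back x y)) ⟩
      negOnePow (a + b) * F y * u m
    ∎
    where open ≡-Reasoning
  regroup : ∀ (n y z J L : ℤ) → n + z * (J + L) + y * J ≡ n + (y + z) * J + z * L
  regroup = solve-∀
  sign-power : ∀ j → negOnePow (+ j) ≡ (- + 1) ^ j
  sign-power j = trans (cong negOnePow (sym (ℤP.*-identityˡ (+ j)))) (negOnePow-*-ℕ (+ 1) j)
  term : ∀ j → j ℕ.≤ k →
    negOnePow (+ j) * binom k j * F (a - b) ^ j * F x ^ (k ℕ.∸ j) * u (n + (a - b) * + k + y * + j)
      ≡ binom k j * ((- + 1 * F (a - b)) ^ j * F x ^ (k ℕ.∸ j) * u (n + x * + j + (a - b) * + (k ℕ.∸ j)))
  term j j≤k =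
    trans (cong₂ (λ s i → s * binom k j * F (a - b) ^ j * F x ^ (k ℕ.∸ j) * u i) (sign-power j) index)
          (absorbˡ (- + 1) (binom k j) (F (a - b)) (F x) _ j (k ℕ.∸ j))
    where
    index : n + (a - b) * + k + y * + j ≡ n + x * + j + (a - b) * + (k ℕ.∸ j)
    index = trans (cong (λ K → n + (a - b) * K + y * + j) (+k≡+j++[k∸j] j≤k))
                  (trans (regroup n y (a - b) (+ j) (+ (k ℕ.∸ j)))
                         (cong (λ t → n + t * + j + (a - b) * + (k ℕ.∸ j)) (sym (x-y≡z⇒x≡y+z x y d))))

theorem2 : (g0 g1 : ℤ) → ¬ (g0 ≡ + 0 × g1 ≡ + 0) →
    (k : ℕ) → 1 ℕ.≤ k → (a b n m : ℤ) →
    (sumTo k (λ j → negOnePow ((a + b + + 1) * (+ k - + j)) * binom k j * (F (m - b) ^ j) * (F (m - a) ^ (k ℕ.∸ j)) * G g0 g1 (n - (m - b) * + k + (a - b) * + j))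
      ≡ (F (a - b) ^ k) * G g0 g1 n)
    × (sumTo k (λ j → negOnePow ((a + b) * + j) * binom k j * (F (a - b) ^ j) * (F (m - a) ^ (k ℕ.∸ j)) * G g0 g1 (n - (a - b) * + k + (m - b) * + j))
      ≡ negOnePow ((a + b) * + k) * (F (m - b) ^ k) * G g0 g1 n)
    × (sumTo k (λ j → negOnePow (+ j) * binom k j * (F (a - b) ^ j) * (F (m - b) ^ (k ℕ.∸ j)) * G g0 g1 (n + (a - b) * + k + (m - a) * + j))
      ≡ negOnePow ((a + b) * + k) * (F (m - a) ^ k) * G g0 g1 n)
    × (sumTo k (λ j → negOnePow ((a + b + + 1) * (+ k - + j)) * binom k j * (F (m + a) ^ j) * (F (m + b) ^ (k ℕ.∸ j)) * G g0 g1 (n - (m + a) * + k + (a - b) * + j))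
      ≡ (F (a - b) ^ k) * G g0 g1 n)
    × (sumTo k (λ j → negOnePow ((a + b) * + j) * binom k j * (F (a - b) ^ j) * (F (m + b) ^ (k ℕ.∸ j)) * G g0 g1 (n - (a - b) * + k + (m + a) * + j))
      ≡ negOnePow ((a + b) * + k) * (F (m + a) ^ k) * G g0 g1 n)
    × (sumTo k (λ j → negOnePow (+ j) * binom k j * (F (a - b) ^ j) * (F (m + a) ^ (k ℕ.∸ j)) * G g0 g1 (n + (a - b) * + k + (m + b) * + j))
      ≡ negOnePow ((a + b) * + k) * (F (m + b) ^ k) * G g0 g1 n)
theorem2 g0 g1 _ k _ a b n m =
    binomial-identity₁ G-fib k a b n (m - b) (m - a) (minus-difference a b m)
  , binomial-identity₂ G-fib k a b n (m - b) (m - a) (minus-difference a b m)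
  , binomial-identity₃ G-fib k a b n (m - b) (m - a) (minus-difference a b m)
  , binomial-identity₁ G-fib k a b n (m + a) (m + b) (plus-difference a b m)
  , binomial-identity₂ G-fib k a b n (m + a) (m + b) (plus-difference a b m)
  , binomial-identity₃ G-fib k a b n (m + a) (m + b) (plus-difference a b m)
  where
  G-fib : IsFibonacciLike (G g0 g1)
  G-fib = seqZ-isFibonacciLike g0 g1
  minus-difference : ∀ (a b m : ℤ) → m - b - (m - a) ≡ a - b
  minus-difference = solve-∀
  plus-difference : ∀ (a b m : ℤ) → m + a - (m + b) ≡ a - b
  plus-difference = solve-∀
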